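{- Let $\mathbf{D}$ be a D-core algebra and $x,y\in D$. Then (1a) $\neg(x\sqcap y)=\neg x\vee\neg y$, (1b) $\lrcorner(x\sqcup y)=\lrcorner x\wedge\lrcorner y$, (2a) $\neg(x\vee y)=\neg x\sqcap\neg y$, (2b) $\lrcorner(x\wedge y)=\lrcorner x\sqcup\lrcorner y$.
   Context: Write $x\vee y:=\neg(\neg x\sqcap\neg y)$ and $x\wedge y:=\lrcorner(\lrcorner x\sqcup\lrcorner y)$. A D-core algebra is an algebra $(D;\sqcap,\sqcup,\neg,\lrcorner,\top,\bot)$ of type $(2,2,1,1,0,0)$ satisfying, for all $x,y,z\in D$: $x\sqcap y=y\sqcap x$; $x\sqcup y=y\sqcup x$; $\neg(x\sqcap x)=\neg x$; $\lrcorner(x\sqcup x)=\lrcorner x$; $x\sqcap(x\sqcup y)=x\sqcap x$; $x\sqcup(x\sqcap y)=x\sqcup x$; $x\sqcap(y\vee z)=(x\sqcap y)\vee(x\sqcap z)$; $x\sqcup(y\wedge z)=(x\sqcup y)\wedge(x\sqcup z)$; $\neg\neg(x\sqcap y)=x\sqcap y$; $\lrcorner\lrcorner(x\sqcup y)=x\sqcup y$; $x\sqcap\neg x=\bot$; $x\sqcup\lrcorner x=\top$; $(x\sqcap x)\sqcup(x\sqcap x)=(x\sqcup x)\sqcap(x\sqcup x)$. -}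

module Defs where

open import Level using (Level; suc)
open import Relation.Binary.PropositionalEquality using (_≡_)

record DCoreAlgebra (a : Level) : Set (suc a) where
  infixr 7 _⊓_
  infixr 6 _⊔_
  field
    Carrier : Set a
    _⊓_ : Carrier → Carrier → Carrier
    _⊔_ : Carrier → Carrier → Carrier
    ¬ : Carrier → Carrier
    ⌟ : Carrier → Carrier
    ⊤ : Carrier
    ⊥ : Carrier

  _∨_ : Carrier → Carrier → Carrier
  x ∨ y = ¬ (¬ x ⊓ ¬ y)

  _∧_ : Carrier → Carrier → Carrier
  x ∧ y = ⌟ (⌟ x ⊔ ⌟ y)

  field
    ⊓-comm : ∀ x y → x ⊓ y ≡ y ⊓ x
    ⊔-comm : ∀ x y → x ⊔ y ≡ y ⊔ x
    ¬-⊓-idem : ∀ x → ¬ (x ⊓ x) ≡ ¬ x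
    ⌟-⊔-idem : ∀ x → ⌟ (x ⊔ x) ≡ ⌟ x
    ⊓-absorb : ∀ x y → x ⊓ (x ⊔ y) ≡ x ⊓ x
    ⊔-absorb : ∀ x y → x ⊔ (x ⊓ y) ≡ x ⊔ x
    ⊓-distrib-∨ : ∀ x y z → x ⊓ (y ∨ z) ≡ (x ⊓ y) ∨ (x ⊓ z)
    ⊔-distrib-∧ : ∀ x y z → x ⊔ (y ∧ z) ≡ (x ⊔ y) ∧ (x ⊔ z)
    ¬¬-⊓ : ∀ x y → ¬ (¬ (x ⊓ y)) ≡ x ⊓ y
    ⌟⌟-⊔ : ∀ x y → ⌟ (⌟ (x ⊔ y)) ≡ x ⊔ y
    ⊓-¬ : ∀ x → x ⊓ ¬ x ≡ ⊥
    ⊔-⌟ : ∀ x → x ⊔ ⌟ x ≡ ⊤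
    ⊓⊔-interchange : ∀ x → (x ⊓ x) ⊔ (x ⊓ x) ≡ (x ⊔ x) ⊓ (x ⊔ x)

{-# OPTIONS --safe #-}
-- The axioms are invariant under swapping ⊓ ↔ ⊔, ¬ ↔ ⌟, ⊤ ↔ ⊥, and this swap
-- turns ∨ into ∧. So only the laws for ¬ need a proof; those for ⌟ are the same
-- laws read in the dual algebra. For ¬, the key facts are ¬¬x = x ⊓ x and that
-- ⊓ does not see the doubling y ↦ y ⊓ y = y ∨ y, by distributivity over ∨.

module Submission where

open import Defs
open import Level using (Level)
open import Data.Product using (_×_; _,_)
open import Relation.Binary.PropositionalEquality using (_≡_; sym; cong; cong₂; module ≡-Reasoning)

dual : {a : Level} → DCoreAlgebra a → DCoreAlgebra a
dual D = record
  { Carrier = Carrier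
  ; _⊓_ = _⊔_
  ; _⊔_ = _⊓_
  ; ¬ = ⌟
  ; ⌟ = ¬
  ; ⊤ = ⊥
  ; ⊥ = ⊤
  ; ⊓-comm = ⊔-comm
  ; ⊔-comm = ⊓-comm
  ; ¬-⊓-idem = ⌟-⊔-idem
  ; ⌟-⊔-idem = ¬-⊓-idem
  ; ⊓-absorb = ⊔-absorb
  ; ⊔-absorb = ⊓-absorb
  ; ⊓-distrib-∨ = ⊔-distrib-∧
  ; ⊔-distrib-∧ = ⊓-distrib-∨
  ; ¬¬-⊓ = ⌟⌟-⊔
  ; ⌟⌟-⊔ = ¬¬-⊓
  ; ⊓-¬ = ⊔-⌟
  ; ⊔-⌟ = ⊓-¬
  ; ⊓⊔-interchange = λ x → sym (⊓⊔-interchange x)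
  }
  where open DCoreAlgebra D

module DCoreProperties {a : Level} (D : DCoreAlgebra a) where
  open DCoreAlgebra D
  open ≡-Reasoning

  ¬¬x≡x⊓x : ∀ x → ¬ (¬ x) ≡ x ⊓ x
  ¬¬x≡x⊓x x = begin
    ¬ (¬ x)        ≡⟨ cong ¬ (¬-⊓-idem x) ⟨
    ¬ (¬ (x ⊓ x))  ≡⟨ ¬¬-⊓ x x ⟩
    x ⊓ x          ∎

  [x⊓y]⊓[x⊓y]≡x⊓y : ∀ x y → (x ⊓ y) ⊓ (x ⊓ y) ≡ x ⊓ y
  [x⊓y]⊓[x⊓y]≡x⊓y x y = begin
    (x ⊓ y) ⊓ (x ⊓ y)  ≡⟨ ¬¬x≡x⊓x (x ⊓ y) ⟨
    ¬ (¬ (x ⊓ y))      ≡⟨ ¬¬-⊓ x y ⟩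
    x ⊓ y              ∎

  x∨x≡x⊓x : ∀ x → x ∨ x ≡ x ⊓ x
  x∨x≡x⊓x x = begin
    ¬ (¬ x ⊓ ¬ x)  ≡⟨ ¬-⊓-idem (¬ x) ⟩
    ¬ (¬ x)        ≡⟨ ¬¬x≡x⊓x x ⟩
    x ⊓ x          ∎

  x⊓[y⊓y]≡x⊓y : ∀ x y → x ⊓ (y ⊓ y) ≡ x ⊓ y
  x⊓[y⊓y]≡x⊓y x y = begin
    x ⊓ (y ⊓ y)        ≡⟨ cong (x ⊓_) (x∨x≡x⊓x y) ⟨
    x ⊓ (y ∨ y)        ≡⟨ ⊓-distrib-∨ x y y ⟩
    (x ⊓ y) ∨ (x ⊓ y)  ≡⟨ x∨x≡x⊓x (x ⊓ y) ⟩
    (x ⊓ y) ⊓ (x ⊓ y)  ≡⟨ [x⊓y]⊓[x⊓y]≡x⊓y x y ⟩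
    x ⊓ y              ∎

  ¬-⊓-deMorgan : ∀ x y → ¬ (x ⊓ y) ≡ ¬ x ∨ ¬ y
  ¬-⊓-deMorgan x y = cong ¬ (begin
    x ⊓ y                  ≡⟨ ⊓-comm y x ⟨
    y ⊓ x                  ≡⟨ x⊓[y⊓y]≡x⊓y y x ⟨
    y ⊓ (x ⊓ x)            ≡⟨ ⊓-comm y (x ⊓ x) ⟩
    (x ⊓ x) ⊓ y            ≡⟨ x⊓[y⊓y]≡x⊓y (x ⊓ x) y ⟨
    (x ⊓ x) ⊓ (y ⊓ y)      ≡⟨ cong₂ _⊓_ (¬¬x≡x⊓x x) (¬¬x≡x⊓x y) ⟨
    ¬ (¬ x) ⊓ ¬ (¬ y)      ∎)

  ¬-∨-deMorgan : ∀ x y → ¬ (x ∨ y) ≡ ¬ x ⊓ ¬ y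
  ¬-∨-deMorgan x y = ¬¬-⊓ (¬ x) (¬ y)

module _ {a : Level} (D : DCoreAlgebra a) where
  open DCoreAlgebra D

  ⌟-⊔-deMorgan : ∀ x y → ⌟ (x ⊔ y) ≡ ⌟ x ∧ ⌟ y
  ⌟-⊔-deMorgan = DCoreProperties.¬-⊓-deMorgan (dual D)

  ⌟-∧-deMorgan : ∀ x y → ⌟ (x ∧ y) ≡ ⌟ x ⊔ ⌟ y
  ⌟-∧-deMorgan = DCoreProperties.¬-∨-deMorgan (dual D)

open DCoreProperties

proposition3p4 : {a : Level} (D : DCoreAlgebra a) → (x y : DCoreAlgebra.Carrier D) → let open DCoreAlgebra D in (¬ (x ⊓ y) ≡ ¬ x ∨ ¬ y) × (⌟ (x ⊔ y) ≡ ⌟ x ∧ ⌟ y) × (¬ (x ∨ y) ≡ ¬ x ⊓ ¬ y) × (⌟ (x ∧ y) ≡ ⌟ x ⊔ ⌟ y)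
proposition3p4 D x y =
  ¬-⊓-deMorgan D x y , ⌟-⊔-deMorgan D x y , ¬-∨-deMorgan D x y , ⌟-∧-deMorgan D x y
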